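{- Let $A$ be a projectable reduced $f$-ring. Then for all $a, b \in A$: $$\exists c \in A\ (a \not\preceq bc - a) \iff (b \mid_{\mathrm{loc}} a \ \text{ and } \ a \neq 0).$$
   Context: All rings are commutative with unity. An $f$-ring is a lattice-ordered ring in which $x \wedge y = 0$ and $z \geq 0$ imply $zx \wedge y = 0$; it is reduced if it has no nonzero nilpotents. Write $x \perp y$ iff $|x| \wedge |y| = 0$, and $S^\perp = \{x : x \perp s \ \forall s \in S\}$. The $f$-ring $A$ is projectable if for every $a \in A$, $A = \{a\}^\perp \oplus \{a\}^{\perp\perp}$. The relation $\preceq$ is defined by $a \preceq b$ iff $\mathrm{Ann}(b) \subseteq \mathrm{Ann}(a)$, i.e. $\forall x\,(bx = 0 \to ax = 0)$. Local divisibility: $y \mid_{\mathrm{loc}} w$ iff $w = 0$ or there exists $w' \neq 0$ with $w'(w - w') = 0$ and $y \mid w'$, where $y \mid w'$ means $w' = yz$ for some $z \in A$. -}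

module Defs where

open import Level using (Level; _⊔_) renaming (suc to lsuc)
open import Algebra.Bundles using (CommutativeRing)
open import Algebra.Core using (Op₂)
open import Relation.Binary.Core using (Rel)
open import Relation.Binary.Lattice.Structures using (IsLattice)
open import Data.Nat.Base using (ℕ; zero; suc)
open import Data.Product using (Σ; ∃; ∃-syntax; _×_)
open import Data.Sum using (_⊎_)
open import Relation.Nullary using (¬_)

record FRing (c ℓ₁ ℓ₂ : Level) : Set (lsuc (c ⊔ ℓ₁ ⊔ ℓ₂)) where
  field
    commutativeRing : CommutativeRing c ℓ₁
  open CommutativeRing commutativeRing public
  infix 4 _≤_
  infixr 6 _∨_
  infixr 7 _∧_
  field
    _≤_       : Rel Carrier ℓ₂
    _∨_       : Op₂ Carrier
    _∧_       : Op₂ Carrier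
    isLattice : IsLattice _≈_ _≤_ _∨_ _∧_
    +-mono-≤  : ∀ {x y} z → x ≤ y → x + z ≤ y + z
    *-nonneg  : ∀ {x y} → 0# ≤ x → 0# ≤ y → 0# ≤ x * y
    f-axiom   : ∀ {x y z} → x ∧ y ≈ 0# → 0# ≤ z → (z * x) ∧ y ≈ 0#

module _ {c ℓ₁ ℓ₂} (A : FRing c ℓ₁ ℓ₂) where
  open FRing A

  ∣_∣ : Carrier → Carrier
  ∣ x ∣ = x ∨ (- x)

  _^_ : Carrier → ℕ → Carrier
  x ^ zero  = 1#
  x ^ suc n = x * (x ^ n)

  Reduced : Set (c ⊔ ℓ₁)
  Reduced = ∀ x n → x ^ n ≈ 0# → x ≈ 0#

  _⊥_ : Carrier → Carrier → Set ℓ₁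
  x ⊥ y = ∣ x ∣ ∧ ∣ y ∣ ≈ 0#

  InPerp : Carrier → Carrier → Set ℓ₁
  InPerp a x = x ⊥ a

  InPerpPerp : Carrier → Carrier → Set (c ⊔ ℓ₁)
  InPerpPerp a x = ∀ y → InPerp a y → x ⊥ y

  -- projectable: A = {a}^⊥ ⊕ {a}^⊥⊥ (internal direct sum) for every a
  Projectable : Set (c ⊔ ℓ₁)
  Projectable = ∀ a →
    (∀ x → ∃[ y ] ∃[ z ] (InPerp a y × InPerpPerp a z × x ≈ y + z))
    × (∀ x → InPerp a x → InPerpPerp a x → x ≈ 0#)

  _≼_ : Carrier → Carrier → Set (c ⊔ ℓ₁)
  a ≼ b = ∀ x → b * x ≈ 0# → a * x ≈ 0#

  _∣_ : Carrier → Carrier → Set (c ⊔ ℓ₁)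
  y ∣ w = ∃[ z ] w ≈ y * z

  _∣loc_ : Carrier → Carrier → Set (c ⊔ ℓ₁)
  y ∣loc w = w ≈ 0# ⊎ ∃[ w′ ] (¬ w′ ≈ 0# × w′ * (w - w′) ≈ 0# × y ∣ w′)

{-# OPTIONS --safe #-}

-- In a reduced f-ring, xy = 0 iff x ⊥ y. If x ⊥ y, the parts x⁺, x⁻, y⁺, y⁻ are
-- pairwise disjoint across x and y, and disjoint positive elements multiply to 0 by
-- the f-ring axiom. If xy = 0, then (x⁺)²y = x⁺(xy) = 0, so (x⁺)²y⁺ = (x⁺)²y⁻; these
-- are also disjoint, hence 0, and reducedness gives x⁺y± = 0 (likewise for x⁻).
-- Then (∣x∣ ∧ ∣y∣)² ≤ (x⁺ + x⁻)(y⁺ + y⁻) = 0.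
-- Consequently projectability, applied to 1 = e + f with e ∈ {d}^⊥, f ∈ {d}^⊥⊥,
-- makes e an identity element of Ann(d). For d = bc − a the witness of b ∣loc a is
-- w′ = ea: it equals b(ec), satisfies w′(a − w′) = 0 since e is idempotent, and is
-- nonzero precisely because Ann(d) ⊄ Ann(a). Conversely, from w′ = bz ≠ 0 with
-- w′(a − w′) = 0 we get (bz − a)w′ = 0 and aw′ = w′², so a ≼ bz − a would make
-- w′ nilpotent.

module Submission where

open import Defs hiding (∣_∣)
open import Data.Product using (∃-syntax; _×_; _,_; proj₁; proj₂)
open import Data.Sum using (inj₁; inj₂)
open import Function.Bundles using (_⇔_; mk⇔)
open import Relation.Binary.Lattice.Bundles using (Lattice)
open import Relation.Binary.Lattice.Structures using (IsLattice)
open import Relation.Nullary using (¬_; contradiction)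

module FRingProperties {c ℓ₁ ℓ₂} (A : FRing c ℓ₁ ℓ₂) where

  open FRing A
  open import Algebra.Properties.Ring ring
    using (-0#≈0#; -‿distribˡ-*; x[y-z]≈xy-xz; [y-z]x≈yx-zx)
  open import Algebra.Properties.Group +-group
    using (//-rightDividesˡ; //-rightDividesʳ; x∙y⁻¹≈ε⇒x≈y; x≈y⇒x∙y⁻¹≈ε)
  open import Algebra.Properties.CommutativeSemigroup *-commutativeSemigroup
    using (interchange; x∙yz≈y∙xz)

  lattice : Lattice c ℓ₁ ℓ₂
  lattice = record { isLattice = isLattice }

  open Lattice lattice using (poset; joinSemilattice; meetSemilattice)
  open IsLattice isLattice
    using (x≤x∨y; y≤x∨y; ∨-least; x∧y≤x; x∧y≤y; ∧-greatest)
    renaming (refl to ≤-refl; trans to ≤-trans; antisym to ≤-antisym; reflexive to ≤-reflexive)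
  open import Relation.Binary.Lattice.Properties.JoinSemilattice joinSemilattice
    using (∨-monotonic; ∨-cong; ∨-comm)
  open import Relation.Binary.Lattice.Properties.MeetSemilattice meetSemilattice
    using (∧-monotonic; ∧-cong; ∧-comm; ∧-idempotent)
  open import Relation.Binary.Reasoning.PartialOrder poset

  x+z≤y⇒x≤y-z : ∀ {x y z} → x + z ≤ y → x ≤ y - z
  x+z≤y⇒x≤y-z {x} {y} {z} x+z≤y = begin
    x          ≈⟨ //-rightDividesʳ z x ⟨
    x + z - z  ≤⟨ +-mono-≤ (- z) x+z≤y ⟩
    y - z      ∎

  x≤y-z⇒x+z≤y : ∀ {x y z} → x ≤ y - z → x + z ≤ y
  x≤y-z⇒x+z≤y {x} {y} {z} x≤y-z = begin
    x + z      ≤⟨ +-mono-≤ z x≤y-z ⟩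
    y - z + z  ≈⟨ //-rightDividesˡ z y ⟩
    y          ∎

  x≤y⇒0≤y-x : ∀ {x y} → x ≤ y → 0# ≤ y - x
  x≤y⇒0≤y-x {x} x≤y = x+z≤y⇒x≤y-z (≤-trans (≤-reflexive (+-identityˡ x)) x≤y)

  0≤y-x⇒x≤y : ∀ {x y} → 0# ≤ y - x → x ≤ y
  0≤y-x⇒x≤y {x} 0≤y-x = ≤-trans (≤-reflexive (sym (+-identityˡ x))) (x≤y-z⇒x+z≤y 0≤y-x)

  +-mono₂-≤ : ∀ {x y u v} → x ≤ y → u ≤ v → x + u ≤ y + v
  +-mono₂-≤ {x} {y} {u} {v} x≤y u≤v = begin
    x + u  ≤⟨ +-mono-≤ u x≤y ⟩
    y + u  ≈⟨ +-comm y u ⟩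
    u + y  ≤⟨ +-mono-≤ y u≤v ⟩
    v + y  ≈⟨ +-comm v y ⟩
    y + v  ∎

  ∨-distribʳ-+ : ∀ x y z → (x ∨ y) + z ≈ (x + z) ∨ (y + z)
  ∨-distribʳ-+ x y z = ≤-antisym
    (x≤y-z⇒x+z≤y (∨-least (x+z≤y⇒x≤y-z (x≤x∨y _ _)) (x+z≤y⇒x≤y-z (y≤x∨y _ _))))
    (∨-least (+-mono-≤ z (x≤x∨y x y)) (+-mono-≤ z (y≤x∨y x y)))

  infix 10 _⁺ _⁻

  _⁺ : Carrier → Carrier
  x ⁺ = x ∨ 0#

  _⁻ : Carrier → Carrier
  x ⁻ = (- x) ⁺

  ∣_∣ : Carrier → Carrier
  ∣ x ∣ = x ∨ - x

  0≤x⁺ : ∀ x → 0# ≤ x ⁺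
  0≤x⁺ x = y≤x∨y x 0#

  x⁻+x≈x⁺ : ∀ x → x ⁻ + x ≈ x ⁺
  x⁻+x≈x⁺ x = begin-equality
    (- x ∨ 0#) + x        ≈⟨ ∨-distribʳ-+ (- x) 0# x ⟩
    (- x + x) ∨ (0# + x)  ≈⟨ ∨-cong (-‿inverseˡ x) (+-identityˡ x) ⟩
    0# ∨ x                ≈⟨ ∨-comm 0# x ⟩
    x ⁺                   ∎

  x≈x⁺-x⁻ : ∀ x → x ≈ x ⁺ - x ⁻
  x≈x⁺-x⁻ x = begin-equality
    x                ≈⟨ //-rightDividesʳ (x ⁻) x ⟨
    x + x ⁻ - x ⁻    ≈⟨ +-congʳ (+-comm x (x ⁻)) ⟩
    x ⁻ + x - x ⁻    ≈⟨ +-congʳ (x⁻+x≈x⁺ x) ⟩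
    x ⁺ - x ⁻        ∎

  x⁺∧x⁻≈0 : ∀ x → x ⁺ ∧ x ⁻ ≈ 0#
  x⁺∧x⁻≈0 x = ≤-antisym s≤0 (∧-greatest (0≤x⁺ x) (0≤x⁺ (- x)))
    where
    s : Carrier
    s = x ⁺ ∧ x ⁻
    x⁺≤x⁺-s : x ⁺ ≤ x ⁺ - s
    x⁺≤x⁺-s = ∨-least
      (x+z≤y⇒x≤y-z (begin
        x + s    ≈⟨ +-comm x s ⟩
        s + x    ≤⟨ +-mono-≤ x (x∧y≤y (x ⁺) (x ⁻)) ⟩
        x ⁻ + x  ≈⟨ x⁻+x≈x⁺ x ⟩
        x ⁺      ∎))
      (x≤y⇒0≤y-x (x∧y≤x (x ⁺) (x ⁻)))
    s≤0 : s ≤ 0#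
    s≤0 = begin
      s            ≤⟨ x+z≤y⇒x≤y-z (≤-trans (≤-reflexive (+-comm s (x ⁺))) (x≤y-z⇒x+z≤y x⁺≤x⁺-s)) ⟩
      x ⁺ - x ⁺    ≈⟨ -‿inverseʳ (x ⁺) ⟩
      0#           ∎

  0≤x+x⇒0≤x : ∀ {x} → 0# ≤ x + x → 0# ≤ x
  0≤x+x⇒0≤x {x} 0≤x+x = begin
    0#               ≤⟨ x+z≤y⇒x≤y-z 0+x⁻≤x+x⁻ ⟩
    x + x ⁻ - x ⁻    ≈⟨ //-rightDividesʳ (x ⁻) x ⟩
    x                ∎
    where
    -x≤x : - x ≤ x
    -x≤x = begin
      - x        ≤⟨ x+z≤y⇒x≤y-z (≤-trans (≤-reflexive (-‿inverseˡ x)) 0≤x+x) ⟩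
      x + x - x  ≈⟨ //-rightDividesʳ x x ⟩
      x          ∎
    0+x⁻≤x+x⁻ : 0# + x ⁻ ≤ x + x ⁻
    0+x⁻≤x+x⁻ = begin
      0# + x ⁻  ≈⟨ +-identityˡ (x ⁻) ⟩
      x ⁻       ≤⟨ ∨-monotonic -x≤x ≤-refl ⟩
      x ⁺       ≈⟨ x⁻+x≈x⁺ x ⟨
      x ⁻ + x   ≈⟨ +-comm (x ⁻) x ⟩
      x + x ⁻   ∎

  0≤∣x∣ : ∀ x → 0# ≤ ∣ x ∣
  0≤∣x∣ x = 0≤x+x⇒0≤x (begin
    0#                ≈⟨ -‿inverseʳ x ⟨
    x - x             ≤⟨ +-mono₂-≤ (x≤x∨y x (- x)) (y≤x∨y x (- x)) ⟩
    ∣ x ∣ + ∣ x ∣     ∎)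

  0≤x⁺≤∣x∣ : ∀ x → 0# ≤ x ⁺ × x ⁺ ≤ ∣ x ∣
  0≤x⁺≤∣x∣ x = 0≤x⁺ x , ∨-least (x≤x∨y x (- x)) (0≤∣x∣ x)

  0≤x⁻≤∣x∣ : ∀ x → 0# ≤ x ⁻ × x ⁻ ≤ ∣ x ∣
  0≤x⁻≤∣x∣ x = 0≤x⁺ (- x) , ∨-least (y≤x∨y x (- x)) (0≤∣x∣ x)

  ∣x∣≤x⁺+x⁻ : ∀ x → ∣ x ∣ ≤ x ⁺ + x ⁻
  ∣x∣≤x⁺+x⁻ x = ∨-least
    (≤-trans (≤-reflexive (sym (+-identityʳ x))) (+-mono₂-≤ (x≤x∨y x 0#) (0≤x⁺ (- x))))
    (≤-trans (≤-reflexive (sym (+-identityˡ (- x)))) (+-mono₂-≤ (0≤x⁺ x) (x≤x∨y (- x) 0#)))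

  x*y≈x*z⇒x*[y-z]≈0 : ∀ x {y z} → x * y ≈ x * z → x * (y - z) ≈ 0#
  x*y≈x*z⇒x*[y-z]≈0 x {y} {z} xy≈xz = trans (x[y-z]≈xy-xz x y z) (x≈y⇒x∙y⁻¹≈ε xy≈xz)

  x*[y-z]≈0⇒x*y≈x*z : ∀ x {y z} → x * (y - z) ≈ 0# → x * y ≈ x * z
  x*[y-z]≈0⇒x*y≈x*z x {y} {z} x[y-z]≈0 = x∙y⁻¹≈ε⇒x≈y _ _ (trans (sym (x[y-z]≈xy-xz x y z)) x[y-z]≈0)

  *-monoˡ-≤ : ∀ {x y} z → 0# ≤ z → x ≤ y → x * z ≤ y * z
  *-monoˡ-≤ {x} {y} z 0≤z x≤y = 0≤y-x⇒x≤y (begin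
    0#             ≤⟨ *-nonneg (x≤y⇒0≤y-x x≤y) 0≤z ⟩
    (y - x) * z    ≈⟨ [y-z]x≈yx-zx z y x ⟩
    y * z - x * z  ∎)

  *-mono-≤ : ∀ {x y u v} → 0# ≤ x → x ≤ y → 0# ≤ u → u ≤ v → x * u ≤ y * v
  *-mono-≤ {x} {y} {u} {v} 0≤x x≤y 0≤u u≤v = begin
    x * u  ≤⟨ *-monoˡ-≤ u 0≤u x≤y ⟩
    y * u  ≈⟨ *-comm y u ⟩
    u * y  ≤⟨ *-monoˡ-≤ y (≤-trans 0≤x x≤y) u≤v ⟩
    v * y  ≈⟨ *-comm v y ⟩
    y * v  ∎

  x∧y≈0⇒0≤x : ∀ {x y} → x ∧ y ≈ 0# → 0# ≤ x
  x∧y≈0⇒0≤x {x} {y} x∧y≈0 = ≤-trans (≤-reflexive (sym x∧y≈0)) (x∧y≤x x y)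

  x∧y≈0⇒0≤y : ∀ {x y} → x ∧ y ≈ 0# → 0# ≤ y
  x∧y≈0⇒0≤y {x} {y} x∧y≈0 = ≤-trans (≤-reflexive (sym x∧y≈0)) (x∧y≤y x y)

  x≈y⇒x∧y≈0⇒x≈0 : ∀ {x y} → x ≈ y → x ∧ y ≈ 0# → x ≈ 0#
  x≈y⇒x∧y≈0⇒x≈0 {x} x≈y x∧y≈0 = trans (sym (∧-idempotent x)) (trans (∧-cong refl x≈y) x∧y≈0)

  f-axiom₂ : ∀ {x y z w} → x ∧ y ≈ 0# → 0# ≤ z → 0# ≤ w → (z * x) ∧ (w * y) ≈ 0#
  f-axiom₂ {x} {y} {z} {w} x∧y≈0 0≤z 0≤w =
    trans (∧-comm (z * x) (w * y)) (f-axiom (trans (∧-comm y (z * x)) (f-axiom x∧y≈0 0≤z)) 0≤w)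

  x∧y≈0⇒x*y≈0 : ∀ {x y} → x ∧ y ≈ 0# → x * y ≈ 0#
  x∧y≈0⇒x*y≈0 {x} {y} x∧y≈0 = trans (*-comm x y)
    (x≈y⇒x∧y≈0⇒x≈0 (*-comm y x) (f-axiom₂ x∧y≈0 (x∧y≈0⇒0≤y x∧y≈0) (x∧y≈0⇒0≤x x∧y≈0)))

  x⁺*x≈x⁺*x⁺ : ∀ x → x ⁺ * x ≈ x ⁺ * x ⁺
  x⁺*x≈x⁺*x⁺ x = begin-equality
    x ⁺ * x                ≈⟨ *-congˡ (x≈x⁺-x⁻ x) ⟩
    x ⁺ * (x ⁺ - x ⁻)      ≈⟨ x[y-z]≈xy-xz (x ⁺) (x ⁺) (x ⁻) ⟩
    x ⁺ * x ⁺ - x ⁺ * x ⁻  ≈⟨ +-congˡ (-‿cong (x∧y≈0⇒x*y≈0 (x⁺∧x⁻≈0 x))) ⟩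
    x ⁺ * x ⁺ - 0#         ≈⟨ +-congˡ -0#≈0# ⟩
    x ⁺ * x ⁺ + 0#         ≈⟨ +-identityʳ (x ⁺ * x ⁺) ⟩
    x ⁺ * x ⁺              ∎

  x⁺*y≈0⇒x⁻*y≈0⇒x*y≈0 : ∀ {x y} → x ⁺ * y ≈ 0# → x ⁻ * y ≈ 0# → x * y ≈ 0#
  x⁺*y≈0⇒x⁻*y≈0⇒x*y≈0 {x} {y} x⁺y≈0 x⁻y≈0 = begin-equality
    x * y              ≈⟨ *-congʳ (x≈x⁺-x⁻ x) ⟩
    (x ⁺ - x ⁻) * y    ≈⟨ [y-z]x≈yx-zx y (x ⁺) (x ⁻) ⟩
    x ⁺ * y - x ⁻ * y  ≈⟨ x≈y⇒x∙y⁻¹≈ε (trans x⁺y≈0 (sym x⁻y≈0)) ⟩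
    0#                 ∎

  x*y⁺≈0⇒x*y⁻≈0⇒x*y≈0 : ∀ {x y} → x * y ⁺ ≈ 0# → x * y ⁻ ≈ 0# → x * y ≈ 0#
  x*y⁺≈0⇒x*y⁻≈0⇒x*y≈0 {x} {y} xy⁺≈0 xy⁻≈0 = trans (*-comm x y)
    (x⁺*y≈0⇒x⁻*y≈0⇒x*y≈0 (trans (*-comm (y ⁺) x) xy⁺≈0) (trans (*-comm (y ⁻) x) xy⁻≈0))

  ⊥⇒*≈0 : ∀ {x y} → _⊥_ A x y → x * y ≈ 0#
  ⊥⇒*≈0 {x} {y} x⊥y = x⁺*y≈0⇒x⁻*y≈0⇒x*y≈0
    (x*y⁺≈0⇒x*y⁻≈0⇒x*y≈0 (disjoint (0≤x⁺≤∣x∣ x) (0≤x⁺≤∣x∣ y)) (disjoint (0≤x⁺≤∣x∣ x) (0≤x⁻≤∣x∣ y)))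
    (x*y⁺≈0⇒x*y⁻≈0⇒x*y≈0 (disjoint (0≤x⁻≤∣x∣ x) (0≤x⁺≤∣x∣ y)) (disjoint (0≤x⁻≤∣x∣ x) (0≤x⁻≤∣x∣ y)))
    where
    disjoint : ∀ {u v} → 0# ≤ u × u ≤ ∣ x ∣ → 0# ≤ v × v ≤ ∣ y ∣ → u * v ≈ 0#
    disjoint (0≤u , u≤∣x∣) (0≤v , v≤∣y∣) = x∧y≈0⇒x*y≈0
      (≤-antisym (≤-trans (∧-monotonic u≤∣x∣ v≤∣y∣) (≤-reflexive x⊥y)) (∧-greatest 0≤u 0≤v))

  module _ (reduced : Reduced A) where

    x*x≈0⇒x≈0 : ∀ {x} → x * x ≈ 0# → x ≈ 0#
    x*x≈0⇒x≈0 {x} x*x≈0 = reduced x 2 (trans (*-congˡ (*-identityʳ x)) x*x≈0)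

    [x*x]*y≈0⇒x*y±≈0 : ∀ {x y} → 0# ≤ x → (x * x) * y ≈ 0# → x * y ⁺ ≈ 0# × x * y ⁻ ≈ 0#
    [x*x]*y≈0⇒x*y±≈0 {x} {y} 0≤x xxy≈0 = x*z≈0 xxy⁺≈0 , x*z≈0 (trans (sym xxy⁺≈xxy⁻) xxy⁺≈0)
      where
      0≤xx : 0# ≤ x * x
      0≤xx = *-nonneg 0≤x 0≤x
      xxy⁺≈xxy⁻ : (x * x) * y ⁺ ≈ (x * x) * y ⁻
      xxy⁺≈xxy⁻ = x*[y-z]≈0⇒x*y≈x*z (x * x) (trans (*-congˡ (sym (x≈x⁺-x⁻ y))) xxy≈0)
      xxy⁺≈0 : (x * x) * y ⁺ ≈ 0#
      xxy⁺≈0 = x≈y⇒x∧y≈0⇒x≈0 xxy⁺≈xxy⁻ (f-axiom₂ (x⁺∧x⁻≈0 y) 0≤xx 0≤xx)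
      x*z≈0 : ∀ {z} → (x * x) * z ≈ 0# → x * z ≈ 0#
      x*z≈0 {z} xxz≈0 = x*x≈0⇒x≈0 (begin-equality
        (x * z) * (x * z)  ≈⟨ interchange x z x z ⟩
        (x * x) * (z * z)  ≈⟨ *-assoc (x * x) z z ⟨
        ((x * x) * z) * z  ≈⟨ *-congʳ xxz≈0 ⟩
        0# * z             ≈⟨ zeroˡ z ⟩
        0#                 ∎)

    *≈0⇒⊥ : ∀ {x y} → x * y ≈ 0# → _⊥_ A x y
    *≈0⇒⊥ {x} {y} xy≈0 = x*x≈0⇒x≈0 (≤-antisym mm≤0 (*-nonneg 0≤m 0≤m))
      where
      m : Carrier
      m = ∣ x ∣ ∧ ∣ y ∣
      0≤m : 0# ≤ m
      0≤m = ∧-greatest (0≤∣x∣ x) (0≤∣x∣ y)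
      u*[y⁺+y⁻]≈0 : ∀ {u z} → 0# ≤ u → u * z ≈ u * u → z * y ≈ 0# → u * (y ⁺ + y ⁻) ≈ 0#
      u*[y⁺+y⁻]≈0 {u} {z} 0≤u uz≈uu zy≈0 = begin-equality
        u * (y ⁺ + y ⁻)    ≈⟨ distribˡ u (y ⁺) (y ⁻) ⟩
        u * y ⁺ + u * y ⁻  ≈⟨ +-cong (proj₁ uy±≈0) (proj₂ uy±≈0) ⟩
        0# + 0#            ≈⟨ +-identityʳ 0# ⟩
        0#                 ∎
        where
        uy±≈0 : u * y ⁺ ≈ 0# × u * y ⁻ ≈ 0#
        uy±≈0 = [x*x]*y≈0⇒x*y±≈0 0≤u (begin-equality
          (u * u) * y  ≈⟨ *-congʳ uz≈uu ⟨
          (u * z) * y  ≈⟨ *-assoc u z y ⟩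
          u * (z * y)  ≈⟨ *-congˡ zy≈0 ⟩
          u * 0#       ≈⟨ zeroʳ u ⟩
          0#           ∎)
      -x*y≈0 : - x * y ≈ 0#
      -x*y≈0 = trans (sym (-‿distribˡ-* x y)) (trans (-‿cong xy≈0) -0#≈0#)
      mm≤0 : m * m ≤ 0#
      mm≤0 = begin
        m * m
          ≤⟨ *-mono-≤ 0≤m (≤-trans (x∧y≤x _ _) (∣x∣≤x⁺+x⁻ x)) 0≤m (≤-trans (x∧y≤y _ _) (∣x∣≤x⁺+x⁻ y)) ⟩
        (x ⁺ + x ⁻) * (y ⁺ + y ⁻)
          ≈⟨ distribʳ (y ⁺ + y ⁻) (x ⁺) (x ⁻) ⟩
        x ⁺ * (y ⁺ + y ⁻) + x ⁻ * (y ⁺ + y ⁻)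
          -- x ⁻ is (- x) ⁺, so the x ⁻ summand is the x ⁺ summand for - x.
          ≈⟨ +-cong (u*[y⁺+y⁻]≈0 (0≤x⁺ x) (x⁺*x≈x⁺*x⁺ x) xy≈0)
                    (u*[y⁺+y⁻]≈0 (0≤x⁺ (- x)) (x⁺*x≈x⁺*x⁺ (- x)) -x*y≈0) ⟩
        0# + 0#
          ≈⟨ +-identityʳ 0# ⟩
        0# ∎

    ∣loc⇒¬≼ : ∀ {a b} → _∣loc_ A b a × ¬ a ≈ 0# → ∃[ x ] ¬ (_≼_ A a (b * x - a))
    ∣loc⇒¬≼ (inj₁ a≈0 , a≉0) = contradiction a≈0 a≉0
    ∣loc⇒¬≼ {a} {b} (inj₂ (w , w≉0 , w[a-w]≈0 , z , w≈bz) , _) =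
      z , λ a≼bz-a → w≉0 (x*x≈0⇒x≈0 (begin-equality
        w * w  ≈⟨ wa≈ww ⟨
        w * a  ≈⟨ *-comm w a ⟩
        a * w  ≈⟨ a≼bz-a w [bz-a]w≈0 ⟩
        0#     ∎))
      where
      wa≈ww : w * a ≈ w * w
      wa≈ww = x*[y-z]≈0⇒x*y≈x*z w w[a-w]≈0
      [bz-a]w≈0 : (b * z - a) * w ≈ 0#
      [bz-a]w≈0 = begin-equality
        (b * z - a) * w  ≈⟨ *-congʳ (+-congʳ w≈bz) ⟨
        (w - a) * w      ≈⟨ *-comm (w - a) w ⟩
        w * (w - a)      ≈⟨ x*y≈x*z⇒x*[y-z]≈0 w (sym wa≈ww) ⟩
        0#               ∎

    module _ (projectable : Projectable A) where

      annihilator-has-identity : ∀ d → ∃[ e ] (e * d ≈ 0# × (∀ y → d * y ≈ 0# → e * y ≈ y))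
      annihilator-has-identity d with proj₁ (projectable d) 1#
      ... | e , f , e⊥d , f∈d⊥⊥ , 1≈e+f = e , ⊥⇒*≈0 e⊥d , e*y≈y
        where
        e*y≈y : ∀ y → d * y ≈ 0# → e * y ≈ y
        e*y≈y y dy≈0 = begin-equality
          e * y          ≈⟨ +-identityʳ (e * y) ⟨
          e * y + 0#     ≈⟨ +-congˡ (⊥⇒*≈0 (f∈d⊥⊥ y (*≈0⇒⊥ (trans (*-comm y d) dy≈0)))) ⟨
          e * y + f * y  ≈⟨ distribʳ y e f ⟨
          (e + f) * y    ≈⟨ *-congʳ 1≈e+f ⟨
          1# * y         ≈⟨ *-identityˡ y ⟩
          y              ∎

      ¬≼⇒∣loc : ∀ {a b} → ∃[ x ] ¬ (_≼_ A a (b * x - a)) → _∣loc_ A b a × ¬ a ≈ 0#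
      ¬≼⇒∣loc {a} {b} (x , a⋠d) with annihilator-has-identity (b * x - a)
      ... | e , ed≈0 , e*y≈y = inj₂ (e * a , ea≉0 , ea[a-ea]≈0 , e * x , ea≈b[ex]) , a≉0
        where
        a≉0 : ¬ a ≈ 0#
        a≉0 a≈0 = a⋠d (λ y _ → trans (*-congʳ a≈0) (zeroˡ y))
        ea≉0 : ¬ e * a ≈ 0#
        ea≉0 ea≈0 = a⋠d (λ y dy≈0 → begin-equality
          a * y        ≈⟨ *-congˡ (e*y≈y y dy≈0) ⟨
          a * (e * y)  ≈⟨ *-assoc a e y ⟨
          (a * e) * y  ≈⟨ *-congʳ (trans (*-comm a e) ea≈0) ⟩
          0# * y       ≈⟨ zeroˡ y ⟩
          0#           ∎)
        ea[a-ea]≈0 : (e * a) * (a - e * a) ≈ 0#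
        ea[a-ea]≈0 = x*y≈x*z⇒x*[y-z]≈0 (e * a) (begin-equality
          (e * a) * a        ≈⟨ *-assoc e a a ⟩
          e * (a * a)        ≈⟨ *-congʳ (e*y≈y e (trans (*-comm _ e) ed≈0)) ⟨
          (e * e) * (a * a)  ≈⟨ interchange e a e a ⟨
          (e * a) * (e * a)  ∎)
        ea≈b[ex] : e * a ≈ b * (e * x)
        ea≈b[ex] = begin-equality
          e * a        ≈⟨ x*[y-z]≈0⇒x*y≈x*z e ed≈0 ⟨
          e * (b * x)  ≈⟨ x∙yz≈y∙xz e b x ⟩
          b * (e * x)  ∎

proposition4p4 : ∀ {c ℓ₁ ℓ₂} (A : FRing c ℓ₁ ℓ₂) → Projectable A → Reduced A →
    let open FRing A in
    ∀ a b → (∃[ x ] ¬ (_≼_ A a (b * x - a))) ⇔ (_∣loc_ A b a × ¬ a ≈ 0#)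
proposition4p4 A projectable reduced a b = mk⇔ (¬≼⇒∣loc reduced projectable) (∣loc⇒¬≼ reduced)
  where open FRingProperties A
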